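{- Let $t$ be an ordinary $\lambda$-term and $\rho: t\to^k u$ an LOU derivation. Then every ${\tt ls}$-step of $\rho$ duplicates a subterm of $t$ (subterm property), $|u|_{[\,]}=|\rho|_{\tt dB}$ (trace property), and every term of $\rho$ is shallow (no explicit substitution contains an explicit substitution in its content).
   Context: LSC terms: $t::= x\mid \lambda x.t\mid tu\mid t[x\leftarrow u]$ (explicit substitution (ES) binding $x$), modulo $\alpha$; $\lambda$-terms have no ES; $|u|_{[\,]}$ counts ES, $|\rho|_{\tt dB}$ counts ${\tt dB}$-steps. Shallow contexts $C::=\langle\cdot\rangle\mid \lambda x.C\mid Ct\mid tC\mid C[x\leftarrow t]$; substitution contexts $L::=\langle\cdot\rangle\mid L[x\leftarrow t]$; applicative contexts $A::=C\langle L\,t\rangle$. Reduction: closure under shallow contexts of ${\tt dB}$: $(L\langle\lambda x.t\rangle)u\to L\langle t[x\leftarrow u]\rangle$ and ${\tt ls}$: $C\langle x\rangle[x\leftarrow u]\to C\langle u\rangle[x\leftarrow u]$ ($C$ not capturing $x$), the latter duplicating $u$; compact form of ${\tt ls}$: $E\langle x\rangle\to E\langle u\rangle$ with $E=D\langle C[x\leftarrow u]\rangle$ for $D\langle C\langle x\rangle[x\leftarrow u]\rangle\to D\langle C\langle u\rangle[x\leftarrow u]\rangle$. Unfolding $x\!\downarrow=x$, $(tu)\!\downarrow=t\!\downarrow u\!\downarrow$, $(\lambda x.t)\!\downarrow=\lambda x.t\!\downarrow$, $(t[x\leftarrow u])\!\downarrow=t\!\downarrow\{x\leftarrow u\!\downarrow\}$;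 relative unfolding $t\!\downarrow_{\langle\cdot\rangle}=t\!\downarrow$, $t\!\downarrow_{uC}=t\!\downarrow_{Cu}=t\!\downarrow_{\lambda x.C}=t\!\downarrow_C$, $t\!\downarrow_{C[x\leftarrow u]}=t\!\downarrow_C\{x\leftarrow u\!\downarrow\}$. Useful redex: ${\tt dB}$-redex, or compact ${\tt ls}$-redex $C\langle x\rangle\to C\langle r\rangle$ with $r\!\downarrow_C$ containing a $\beta$-redex, or $r\!\downarrow_C$ an abstraction and $C$ applicative. Positions: ${\tt dB}$-redex $C\langle L\langle\lambda x.t\rangle u\rangle$ has position $C$; compact ${\tt ls}$-redex $C\langle x\rangle\to C\langle u\rangle$ has position $C$. $C\prec_p t$ means $t=C\langle u\rangle$. $\prec_O$: $\langle\cdot\rangle\prec_O C$ for $C\neq\langle\cdot\rangle$, closed under $E\langle\cdot\rangle$. $\prec_L$: if $C\prec_p t$, $D\prec_p u$ then $Cu\prec_L tD$ and $C[x\leftarrow u]\prec_L t[x\leftarrow D]$, closed under $E\langle\cdot\rangle$. $\prec_{LO}=\prec_O\cup\prec_L$. An LOU derivation reduces at each step the $\prec_{LO}$-least useful redex. -}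

module Defs where

open import Data.Nat using (ℕ; zero; suc; _+_)
open import Data.List using (List; []; _∷_; length)
open import Data.Product using (Σ; ∃; _×_; _,_)
open import Data.Sum using (_⊎_)
open import Data.Unit using (⊤)
open import Relation.Binary.PropositionalEquality using (_≡_)
open import Relation.Nullary using (¬_)
open import Function.Definitions using (Injective)

-- LSC terms, de Bruijn representation (so α-equivalence is equality).
-- es t u  represents  t[x←u]  where x is index 0 in t.

data Tm : Set where
  var : ℕ → Tm
  lam : Tm → Tm
  app : Tm → Tm → Tm
  es  : Tm → Tm → Tm

data IsLambda : Tm → Set where
  var : ∀ {n} → IsLambda (var n)
  lam : ∀ {t} → IsLambda t → IsLambda (lam t)
  app : ∀ {t u} → IsLambda t → IsLambda u → IsLambda (app t u)

esCount : Tm → ℕ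
esCount (var _)   = 0
esCount (lam t)   = esCount t
esCount (app t u) = esCount t + esCount u
esCount (es t u)  = suc (esCount t + esCount u)

data Shallow : Tm → Set where
  var : ∀ {n} → Shallow (var n)
  lam : ∀ {t} → Shallow t → Shallow (lam t)
  app : ∀ {t u} → Shallow t → Shallow u → Shallow (app t u)
  es  : ∀ {t u} → Shallow t → IsLambda u → Shallow (es t u)

ext : (ℕ → ℕ) → ℕ → ℕ
ext r zero    = zero
ext r (suc n) = suc (r n)

ren : (ℕ → ℕ) → Tm → Tm
ren r (var n)   = var (r n)
ren r (lam t)   = lam (ren (ext r) t)
ren r (app t u) = app (ren r t) (ren r u)
ren r (es t u)  = es (ren (ext r) t) (ren r u)

weaken : ℕ → Tm → Tm
weaken k = ren (k +_)

exts : (ℕ → Tm) → ℕ → Tm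
exts σ zero    = var zero
exts σ (suc n) = ren suc (σ n)

extsN : ℕ → (ℕ → Tm) → ℕ → Tm
extsN zero    σ = σ
extsN (suc m) σ = exts (extsN m σ)

sub : (ℕ → Tm) → Tm → Tm
sub σ (var n)   = σ n
sub σ (lam t)   = lam (sub (exts σ) t)
sub σ (app t u) = app (sub σ t) (sub σ u)
sub σ (es t u)  = es (sub (exts σ) t) (sub σ u)

sub0 : Tm → ℕ → Tm
sub0 u zero    = u
sub0 u (suc n) = var n

unfold : Tm → Tm
unfold (var n)   = var n
unfold (lam t)   = lam (unfold t)
unfold (app t u) = app (unfold t) (unfold u)
unfold (es t u)  = sub (sub0 (unfold u)) (unfold t)

data Ctx : Set where
  hole : Ctx
  lamC : Ctx → Ctx
  appL : Ctx → Tm → Ctx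
  appR : Tm → Ctx → Ctx
  esL  : Ctx → Tm → Ctx

plug : Ctx → Tm → Tm
plug hole       s = s
plug (lamC C)   s = lam (plug C s)
plug (appL C t) s = app (plug C s) t
plug (appR t C) s = app t (plug C s)
plug (esL C t)  s = es (plug C s) t

_∘C_ : Ctx → Ctx → Ctx
hole       ∘C D = D
lamC C     ∘C D = lamC (C ∘C D)
appL C t   ∘C D = appL (C ∘C D) t
appR t C   ∘C D = appR t (C ∘C D)
esL C t    ∘C D = esL (C ∘C D) t

depth : Ctx → ℕ
depth hole       = 0
depth (lamC C)   = suc (depth C)
depth (appL C _) = depth C
depth (appR _ C) = depth C
depth (esL C _)  = suc (depth C)

lamDepth : Ctx → ℕ
lamDepth hole       = 0
lamDepth (lamC C)   = suc (lamDepth C)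
lamDepth (appL C _) = lamDepth C
lamDepth (appR _ C) = lamDepth C
lamDepth (esL C _)  = lamDepth C

-- relative unfolding s↓_C  (result lives in the context of the hole with the
-- ES-binders of C removed and its λ-binders kept)
unfoldRel : Ctx → Tm → Tm
unfoldRel hole       s = unfold s
unfoldRel (lamC C)   s = unfoldRel C s
unfoldRel (appL C _) s = unfoldRel C s
unfoldRel (appR _ C) s = unfoldRel C s
unfoldRel (esL C u)  s = sub (extsN (lamDepth C) (sub0 (unfold u))) (unfoldRel C s)

-- substitution contexts L ::= ⟨·⟩ | L[x←t]; the head of the list is outermost
SubCtx : Set
SubCtx = List Tm

plugL : SubCtx → Tm → Tm
plugL []      s = s
plugL (u ∷ L) s = es (plugL L s) u

ctxL : SubCtx → Ctx
ctxL []      = hole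
ctxL (u ∷ L) = esL (ctxL L) u

Applicative : Ctx → Set
Applicative E = Σ Ctx λ C → Σ SubCtx λ L → Σ Tm λ t → E ≡ C ∘C appL (ctxL L) t

data HasBeta : Tm → Set where
  here : ∀ {t u} → HasBeta (app (lam t) u)
  lam  : ∀ {t} → HasBeta t → HasBeta (lam t)
  appl : ∀ {t u} → HasBeta t → HasBeta (app t u)
  appr : ∀ {t u} → HasBeta u → HasBeta (app t u)
  esl  : ∀ {t u} → HasBeta t → HasBeta (es t u)
  esr  : ∀ {t u} → HasBeta u → HasBeta (es t u)

IsAbs : Tm → Set
IsAbs s = Σ Tm λ b → s ≡ lam b

data Step : Tm → Tm → Set where
  dB : (C : Ctx) (L : SubCtx) (t u : Tm) →
       Step (plug C (app (plugL L (lam t)) u))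
            (plug C (plugL L (es t (weaken (length L) u))))
  -- D⟨C⟨x⟩[x←u]⟩ → D⟨C⟨u⟩[x←u]⟩  (x = index depth C at the hole, bound by the ES)
  ls : (D C : Ctx) (u : Tm) →
       Step (plug D (es (plug C (var (depth C))) u))
            (plug D (es (plug C (weaken (suc (depth C)) u)) u))

pos : ∀ {s s'} → Step s s' → Ctx
pos (dB C _ _ _) = C
pos (ls D C u)   = D ∘C esL C u

Useful : ∀ {s s'} → Step s s' → Set
Useful (dB _ _ _ _) = ⊤
Useful (ls D C u) =
  HasBeta (unfoldRel E r) ⊎ (IsAbs (unfoldRel E r) × Applicative E)
  where
    E = D ∘C esL C u
    r = weaken (suc (depth C)) u

_≺p_ : Ctx → Tm → Set
C ≺p t = Σ Tm λ u → t ≡ plug C u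

data _≺LO_ : Ctx → Ctx → Set where
  outside : ∀ {C} → ¬ (C ≡ hole) → hole ≺LO C
  left    : ∀ {C t D u} → C ≺p t → D ≺p u → appL C u ≺LO appR t D
  inCtx   : ∀ E {C D} → C ≺LO D → (E ∘C C) ≺LO (E ∘C D)

LOUStep : ∀ {s s'} → Step s s' → Set
LOUStep {s} st = Useful st ×
  (∀ {s''} (st' : Step s s'') → Useful st' → pos st ≡ pos st' ⊎ pos st ≺LO pos st')

data Deriv : Tm → Tm → Set where
  []  : ∀ {t} → Deriv t t
  _∷_ : ∀ {t s u} → Step t s → Deriv s u → Deriv t u

IsLOU : ∀ {t u} → Deriv t u → Set
IsLOU []       = ⊤
IsLOU (st ∷ ρ) = LOUStep st × IsLOU ρ

dBCount : ∀ {t u} → Deriv t u → ℕ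
dBCount []                  = 0
dBCount (dB _ _ _ _ ∷ ρ)    = suc (dBCount ρ)
dBCount (ls _ _ _ ∷ ρ)      = dBCount ρ

terms : ∀ {t u} → Deriv t u → List Tm
terms {t} []       = t ∷ []
terms {t} (_ ∷ ρ)  = t ∷ terms ρ

SubtermUpToRenaming : Tm → Tm → Set
SubtermUpToRenaming w t =
  Σ Ctx λ C → Σ Tm λ s → Σ (ℕ → ℕ) λ r →
    plug C s ≡ t × Injective _≡_ _≡_ r × ren r s ≡ w

SubtermProperty : ∀ {t u} → Tm → Deriv t u → Set
SubtermProperty t0 []                  = ⊤
SubtermProperty t0 (dB _ _ _ _ ∷ ρ)    = SubtermProperty t0 ρ
SubtermProperty t0 (ls _ _ u ∷ ρ)      = SubtermUpToRenaming u t0 × SubtermProperty t0 ρ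

-- Every term s of an LOU derivation from a λ-term t satisfies an invariant: the
-- content of every explicit substitution of s is "pristine" (a λ-term that is a
-- subterm of t up to an injective renaming), and so is every argument of an
-- application of s, except for arguments that LOU evaluation has already entered,
-- which have nothing useful outside them or to their left. A dB-step fires at the
-- least useful position, so its argument is not such an entered argument and the
-- substitution it creates has pristine content; an ls-step copies pristine content,
-- which is ES-free and whose subterms are pristine. The subterm property and
-- shallowness are read off the invariant, and the trace property follows because a
-- dB-step creates exactly one substitution while an ls-step copies an ES-free term.

module Submission where

open import Defs
open import Data.Nat using (ℕ; zero; suc; _+_)
open import Data.Nat.Properties
  using (suc-injective; +-suc; +-assoc; +-identityʳ; +-cancelˡ-≡; +-commutativeSemigroup)
open import Algebra.Properties.CommutativeSemigroup +-commutativeSemigroup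
  using (x∙yz≈y∙xz; xy∙z≈xz∙y)
open import Data.List using (List; []; _∷_; _++_; length; replicate)
open import Data.List.Properties using (++-assoc)
open import Data.List.Relation.Unary.All using (All; []; _∷_)
open import Data.List.Relation.Unary.All.Properties using (replicate⁺)
open import Data.List.Relation.Binary.Pointwise as Pointwise using ()
open import Data.List.Relation.Binary.Prefix.Heterogeneous using (Prefix; []; _∷_)
open import Data.List.Relation.Binary.Prefix.Heterogeneous.Properties as Prefix using ()
open import Data.Product using (Σ; _×_; _,_; proj₁; proj₂)
open import Data.Sum using (_⊎_; inj₁; inj₂; map₂; [_,_]′)
open import Data.Unit using (tt)
open import Data.Empty using (⊥-elim)
open import Function using (id; _∘_)
open import Function.Definitions using (Injective)
open import Relation.Binary.PropositionalEquality
open import Relation.Nullary using (¬_)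

-- Contexts and positions

lam-injective : ∀ {a b : Tm} → lam a ≡ lam b → a ≡ b
lam-injective refl = refl

app-injective : ∀ {a b c d : Tm} → app a b ≡ app c d → a ≡ c × b ≡ d
app-injective refl = refl , refl

es-injective : ∀ {a b c d : Tm} → es a b ≡ es c d → a ≡ c × b ≡ d
es-injective refl = refl , refl

∘C-assoc : ∀ A B C → (A ∘C B) ∘C C ≡ A ∘C (B ∘C C)
∘C-assoc hole       B C = refl
∘C-assoc (lamC A)   B C = cong lamC (∘C-assoc A B C)
∘C-assoc (appL A t) B C = cong (λ X → appL X t) (∘C-assoc A B C)
∘C-assoc (appR t A) B C = cong (appR t) (∘C-assoc A B C)
∘C-assoc (esL A u)  B C = cong (λ X → esL X u) (∘C-assoc A B C)

∘C-identityʳ : ∀ C → C ∘C hole ≡ C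
∘C-identityʳ hole       = refl
∘C-identityʳ (lamC C)   = cong lamC (∘C-identityʳ C)
∘C-identityʳ (appL C t) = cong (λ X → appL X t) (∘C-identityʳ C)
∘C-identityʳ (appR t C) = cong (appR t) (∘C-identityʳ C)
∘C-identityʳ (esL C u)  = cong (λ X → esL X u) (∘C-identityʳ C)

plug-∘ : ∀ C D s → plug (C ∘C D) s ≡ plug C (plug D s)
plug-∘ hole       D s = refl
plug-∘ (lamC C)   D s = cong lam (plug-∘ C D s)
plug-∘ (appL C t) D s = cong (λ z → app z t) (plug-∘ C D s)
plug-∘ (appR t C) D s = cong (app t) (plug-∘ C D s)
plug-∘ (esL C u)  D s = cong (λ z → es z u) (plug-∘ C D s)

plug-ctxL : ∀ L s → plug (ctxL L) s ≡ plugL L s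
plug-ctxL []      s = refl
plug-ctxL (u ∷ L) s = cong (λ z → es z u) (plug-ctxL L s)

plugL-++ : ∀ L₁ L₂ s → plugL (L₁ ++ L₂) s ≡ plug (ctxL L₁) (plugL L₂ s)
plugL-++ []       L₂ s = refl
plugL-++ (u ∷ L₁) L₂ s = cong (λ z → es z u) (plugL-++ L₁ L₂ s)

data Dir : Set where
  fun arg lamBody esBody : Dir

path : Ctx → List Dir
path hole       = []
path (lamC C)   = lamBody ∷ path C
path (appL C _) = fun ∷ path C
path (appR _ C) = arg ∷ path C
path (esL C _)  = esBody ∷ path C

path-∘ : ∀ C D → path (C ∘C D) ≡ path C ++ path D
path-∘ hole       D = refl
path-∘ (lamC C)   D = cong (lamBody ∷_) (path-∘ C D)
path-∘ (appL C t) D = cong (fun ∷_) (path-∘ C D)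
path-∘ (appR t C) D = cong (arg ∷_) (path-∘ C D)
path-∘ (esL C u)  D = cong (esBody ∷_) (path-∘ C D)

path-ctxL : ∀ L → path (ctxL L) ≡ replicate (length L) esBody
path-ctxL []      = refl
path-ctxL (u ∷ L) = cong (esBody ∷_) (path-ctxL L)

_⊑_ : List Dir → List Dir → Set
_⊑_ = Prefix _≡_

data _◁_ : List Dir → List Dir → Set where
  fun◁arg : ∀ {p q} → (fun ∷ p) ◁ (arg ∷ q)
  _∷_     : ∀ d {p q} → p ◁ q → (d ∷ p) ◁ (d ∷ q)

_≼_ : List Dir → List Dir → Set
p ≼ q = p ⊑ q ⊎ p ◁ q

ArgFree : List Dir → Set
ArgFree = All (_≢ arg)

spine-ArgFree : ∀ k → ArgFree (fun ∷ replicate k esBody)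
spine-ArgFree k = (λ ()) ∷ replicate⁺ k (λ ())

⊑-refl : ∀ {p} → p ⊑ p
⊑-refl = Prefix.fromPointwise (Pointwise.refl refl)

⊑-trans : ∀ {p q r} → p ⊑ q → q ⊑ r → p ⊑ r
⊑-trans = Prefix.trans trans

p⊑p++q : ∀ p q → p ⊑ (p ++ q)
p⊑p++q []      q = []
p⊑p++q (_ ∷ p) q = refl ∷ p⊑p++q p q

⊑-++⁺ : ∀ e {p q} → p ⊑ q → (e ++ p) ⊑ (e ++ q)
⊑-++⁺ e = Prefix.++⁺ (Pointwise.refl refl {e})

◁-++⁺ : ∀ e {p q} → p ◁ q → (e ++ p) ◁ (e ++ q)
◁-++⁺ []      h = h
◁-++⁺ (d ∷ e) h = d ∷ ◁-++⁺ e h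

≼-++⁺ : ∀ e {p q} → p ≼ q → (e ++ p) ≼ (e ++ q)
≼-++⁺ e (inj₁ h) = inj₁ (⊑-++⁺ e h)
≼-++⁺ e (inj₂ h) = inj₂ (◁-++⁺ e h)

◁-extend : ∀ {p q} z → p ◁ q → (p ++ z) ◁ q
◁-extend z fun◁arg = fun◁arg
◁-extend z (d ∷ h) = d ∷ ◁-extend z h

⊑-◁-trans : ∀ {p q r} → p ⊑ q → q ◁ r → p ≼ r
⊑-◁-trans []            _       = inj₁ []
⊑-◁-trans (refl ∷ _)    fun◁arg = inj₂ fun◁arg
⊑-◁-trans (refl ∷ p⊑q) (d ∷ q◁r) with ⊑-◁-trans p⊑q q◁r
... | inj₁ p⊑r = inj₁ (refl ∷ p⊑r)
... | inj₂ p◁r = inj₂ (d ∷ p◁r)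

◁-⊑-trans : ∀ {p q r} → p ◁ q → q ⊑ r → p ◁ r
◁-⊑-trans fun◁arg   (refl ∷ _)   = fun◁arg
◁-⊑-trans (d ∷ p◁q) (refl ∷ q⊑r) = d ∷ ◁-⊑-trans p◁q q⊑r

◁-trans : ∀ {p q r} → p ◁ q → q ◁ r → p ◁ r
◁-trans fun◁arg   (_ ∷ _)  = fun◁arg
◁-trans (_ ∷ _)   fun◁arg  = fun◁arg
◁-trans (d ∷ p◁q) (_ ∷ q◁r) = d ∷ ◁-trans p◁q q◁r

≼-trans : ∀ {p q r} → p ≼ q → q ≼ r → p ≼ r
≼-trans (inj₁ p⊑q) (inj₁ q⊑r) = inj₁ (⊑-trans p⊑q q⊑r)
≼-trans (inj₁ p⊑q) (inj₂ q◁r) = ⊑-◁-trans p⊑q q◁r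
≼-trans (inj₂ p◁q) (inj₁ q⊑r) = inj₂ (◁-⊑-trans p◁q q⊑r)
≼-trans (inj₂ p◁q) (inj₂ q◁r) = inj₂ (◁-trans p◁q q◁r)

p++d∷q⋠p : ∀ p d q → ¬ ((p ++ d ∷ q) ≼ p)
p++d∷q⋠p []      d q (inj₁ ())
p++d∷q⋠p []      d q (inj₂ ())
p++d∷q⋠p (e ∷ p) d q (inj₁ (refl ∷ h)) = p++d∷q⋠p p d q (inj₁ h)
p++d∷q⋠p (e ∷ p) d q (inj₂ (_ ∷ h))    = p++d∷q⋠p p d q (inj₂ h)

c++arg∷x⋠c++fun∷y : ∀ c x y → ¬ ((c ++ arg ∷ x) ≼ (c ++ fun ∷ y))
c++arg∷x⋠c++fun∷y []      x y (inj₁ (() ∷ _))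
c++arg∷x⋠c++fun∷y []      x y (inj₂ ())
c++arg∷x⋠c++fun∷y (e ∷ c) x y (inj₁ (refl ∷ h)) = c++arg∷x⋠c++fun∷y c x y (inj₁ h)
c++arg∷x⋠c++fun∷y (e ∷ c) x y (inj₂ (_ ∷ h))    = c++arg∷x⋠c++fun∷y c x y (inj₂ h)

p◁q⇒q++z⋠p : ∀ {p q} z → p ◁ q → ¬ ((q ++ z) ≼ p)
p◁q⇒q++z⋠p z fun◁arg (inj₁ (() ∷ _))
p◁q⇒q++z⋠p z fun◁arg (inj₂ ())
p◁q⇒q++z⋠p z (_ ∷ h) (inj₁ (refl ∷ k)) = p◁q⇒q++z⋠p z h (inj₁ k)
p◁q⇒q++z⋠p z (_ ∷ h) (inj₂ (_ ∷ k))    = p◁q⇒q++z⋠p z h (inj₂ k)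

◁-ArgFree : ∀ {p T} → p ◁ T → ¬ ArgFree T
◁-ArgFree fun◁arg (a≢arg ∷ _) = a≢arg refl
◁-ArgFree (_ ∷ h)   (_ ∷ free)  = ◁-ArgFree h free

◁-cut : ∀ {p} q T → p ◁ (q ++ T) → ArgFree T → p ◁ q
◁-cut []      T h       free = ⊥-elim (◁-ArgFree h free)
◁-cut (_ ∷ q) T fun◁arg free = fun◁arg
◁-cut (d ∷ q) T (_ ∷ h) free = d ∷ ◁-cut q T h free

⊑-ArgFree : ∀ y {z T} → (y ++ arg ∷ z) ⊑ T → ¬ ArgFree T
⊑-ArgFree []      (refl ∷ _) (a≢arg ∷ _) = a≢arg refl
⊑-ArgFree (_ ∷ y) (refl ∷ h) (_ ∷ free)  = ⊑-ArgFree y h free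

⊑-cut : ∀ x q T → (x ++ arg ∷ []) ⊑ (q ++ T) → ArgFree T → (x ++ arg ∷ []) ⊑ q
⊑-cut x       []      T h          free = ⊥-elim (⊑-ArgFree x h free)
⊑-cut []      (_ ∷ q) T (refl ∷ _) free = refl ∷ []
⊑-cut (_ ∷ x) (_ ∷ q) T (refl ∷ h) free = refl ∷ ⊑-cut x q T h free

≼-cut : ∀ x q T → (x ++ arg ∷ []) ≼ (q ++ T) → ArgFree T → (x ++ arg ∷ []) ≼ q
≼-cut x q T (inj₁ h) free = inj₁ (⊑-cut x q T h free)
≼-cut x q T (inj₂ h) free = inj₂ (◁-cut q T h free)

≺LO⇒≼ : ∀ {C D} → C ≺LO D → path C ≼ path D
≺LO⇒≼ (outside _)       = inj₁ []
≺LO⇒≼ (left _ _)        = inj₂ fun◁arg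
≺LO⇒≼ (inCtx E {C} {D} h) =
  subst₂ _≼_ (sym (path-∘ E C)) (sym (path-∘ E D)) (≼-++⁺ (path E) (≺LO⇒≼ h))

data Similar : Ctx → Ctx → Set where
  hole : Similar hole hole
  lamC : ∀ {C C'} → Similar C C' → Similar (lamC C) (lamC C')
  appL : ∀ {C C' t t'} → Similar C C' → Similar (appL C t) (appL C' t')
  appR : ∀ {C C' t t'} → Similar C C' → Similar (appR t C) (appR t' C')
  esL  : ∀ {C C' u} → Similar C C' → Similar (esL C u) (esL C' u)

similar-refl : ∀ C → Similar C C
similar-refl hole       = hole
similar-refl (lamC C)   = lamC (similar-refl C)
similar-refl (appL C t) = appL (similar-refl C)
similar-refl (appR t C) = appR (similar-refl C)
similar-refl (esL C u)  = esL (similar-refl C)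

similar-∘ : ∀ {A A' B B'} → Similar A A' → Similar B B' → Similar (A ∘C B) (A' ∘C B')
similar-∘ hole     b = b
similar-∘ (lamC a) b = lamC (similar-∘ a b)
similar-∘ (appL a) b = appL (similar-∘ a b)
similar-∘ (appR a) b = appR (similar-∘ a b)
similar-∘ (esL a)  b = esL (similar-∘ a b)

similar-path : ∀ {C C'} → Similar C C' → path C ≡ path C'
similar-path hole     = refl
similar-path (lamC s) = cong (lamBody ∷_) (similar-path s)
similar-path (appL s) = cong (fun ∷_) (similar-path s)
similar-path (appR s) = cong (arg ∷_) (similar-path s)
similar-path (esL s)  = cong (esBody ∷_) (similar-path s)

similar-depth : ∀ {C C'} → Similar C C' → depth C ≡ depth C'
similar-depth hole     = refl
similar-depth (lamC s) = cong suc (similar-depth s)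
similar-depth (appL s) = similar-depth s
similar-depth (appR s) = similar-depth s
similar-depth (esL s)  = cong suc (similar-depth s)

similar-lamDepth : ∀ {C C'} → Similar C C' → lamDepth C ≡ lamDepth C'
similar-lamDepth hole     = refl
similar-lamDepth (lamC s) = cong suc (similar-lamDepth s)
similar-lamDepth (appL s) = similar-lamDepth s
similar-lamDepth (appR s) = similar-lamDepth s
similar-lamDepth (esL s)  = similar-lamDepth s

similar-unfoldRel : ∀ {C C'} → Similar C C' → ∀ r → unfoldRel C r ≡ unfoldRel C' r
similar-unfoldRel hole     r = refl
similar-unfoldRel (lamC s) r = similar-unfoldRel s r
similar-unfoldRel (appL s) r = similar-unfoldRel s r
similar-unfoldRel (appR s) r = similar-unfoldRel s r
similar-unfoldRel (esL {u = u} s) r =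
  cong₂ (λ k z → sub (extsN k (sub0 (unfold u))) z) (similar-lamDepth s) (similar-unfoldRel s r)

similar-split : ∀ A B {K} → Similar (A ∘C B) K →
  Σ Ctx λ A' → Σ Ctx λ B' → K ≡ A' ∘C B' × Similar A A' × Similar B B'
similar-split hole B s = hole , _ , refl , hole , s
similar-split (lamC A) B (lamC s) with similar-split A B s
... | A' , B' , refl , a , b = lamC A' , B' , refl , lamC a , b
similar-split (appL A t) B (appL {t' = t'} s) with similar-split A B s
... | A' , B' , refl , a , b = appL A' t' , B' , refl , appL a , b
similar-split (appR t A) B (appR {t' = t'} s) with similar-split A B s
... | A' , B' , refl , a , b = appR t' A' , B' , refl , appR a , b
similar-split (esL A u) B (esL s) with similar-split A B s
... | A' , B' , refl , a , b = esL A' u , B' , refl , esL a , b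

similar-ctxL : ∀ L {X} → Similar (ctxL L) X → X ≡ ctxL L
similar-ctxL []      hole    = refl
similar-ctxL (u ∷ L) (esL s) = cong (λ X → esL X u) (similar-ctxL L s)

similar-applicative : ∀ {E E'} → Similar E E' → Applicative E → Applicative E'
similar-applicative s (C , L , t , refl) with similar-split C _ s
... | C' , _ , refl , _ , appL {t' = t'} b with similar-ctxL L b
... | refl = C' , L , t' , refl

Disjoint : Ctx → Ctx → Tm → Set
Disjoint P K y = ∀ x' → Σ Ctx λ K' → plug P x' ≡ plug K' y × Similar K K'

data Overlap (P : Ctx) (x : Tm) (K : Ctx) (y : Tm) : Set where
  inside   : ∀ P' → K ≡ P ∘C P' → x ≡ plug P' y → Overlap P x K y
  encloses : ∀ K' → K' ≢ hole → P ≡ K ∘C K' → y ≡ plug K' x → Overlap P x K y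
  leftOf   : path P ◁ path K → Disjoint P K y → Overlap P x K y
  rightOf  : path K ◁ path P → Disjoint P K y → Overlap P x K y

Disjoint-∘ : ∀ F {P K y} → Disjoint P K y → Disjoint (F ∘C P) (F ∘C K) y
Disjoint-∘ F {P} {K} {y} d x' with d x'
... | K' , e , s = F ∘C K' ,
  trans (plug-∘ F P x') (trans (cong (plug F) e) (sym (plug-∘ F K' y))) ,
  similar-∘ (similar-refl F) s

Overlap-∘ : ∀ F {P x K y} → Overlap P x K y → Overlap (F ∘C P) x (F ∘C K) y
Overlap-∘ F {P}     (inside P' refl e)      = inside P' (sym (∘C-assoc F P P')) e
Overlap-∘ F {K = K} (encloses K' nh refl e) = encloses K' nh (sym (∘C-assoc F K K')) e
Overlap-∘ F {P} {K = K} (leftOf h d) =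
  leftOf (subst₂ _◁_ (sym (path-∘ F P)) (sym (path-∘ F K)) (◁-++⁺ (path F) h)) (Disjoint-∘ F d)
Overlap-∘ F {P} {K = K} (rightOf h d) =
  rightOf (subst₂ _◁_ (sym (path-∘ F K)) (sym (path-∘ F P)) (◁-++⁺ (path F) h)) (Disjoint-∘ F d)

relatePositions : ∀ P x K y → plug P x ≡ plug K y → Overlap P x K y
relatePositions hole       x K          y e = inside K refl e
relatePositions (lamC P)   x hole       y e = encloses (lamC P) (λ ()) refl (sym e)
relatePositions (appL P t) x hole       y e = encloses (appL P t) (λ ()) refl (sym e)
relatePositions (appR t P) x hole       y e = encloses (appR t P) (λ ()) refl (sym e)
relatePositions (esL P u)  x hole       y e = encloses (esL P u) (λ ()) refl (sym e)
relatePositions (lamC P)   x (lamC K)   y e =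
  Overlap-∘ (lamC hole) (relatePositions P x K y (lam-injective e))
relatePositions (appL P t) x (appL K _) y e with app-injective e
... | e₁ , refl = Overlap-∘ (appL hole t) (relatePositions P x K y e₁)
relatePositions (appR t P) x (appR _ K) y e with app-injective e
... | refl , e₂ = Overlap-∘ (appR t hole) (relatePositions P x K y e₂)
relatePositions (esL P u)  x (esL K _)  y e with es-injective e
... | e₁ , refl = Overlap-∘ (esL hole u) (relatePositions P x K y e₁)
relatePositions (appL P t) x (appR _ K) y e =
  leftOf fun◁arg λ x' → appR (plug P x') K , cong (app (plug P x')) (proj₂ (app-injective e)) ,
                        appR (similar-refl K)
relatePositions (appR t P) x (appL K _) y e =
  rightOf fun◁arg λ x' → appL K (plug P x') , cong (λ z → app z (plug P x')) (proj₁ (app-injective e)) ,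
                         appL (similar-refl K)
relatePositions (lamC _)   x (appL _ _) y ()
relatePositions (lamC _)   x (appR _ _) y ()
relatePositions (lamC _)   x (esL _ _)  y ()
relatePositions (appL _ _) x (lamC _)   y ()
relatePositions (appL _ _) x (esL _ _)  y ()
relatePositions (appR _ _) x (lamC _)   y ()
relatePositions (appR _ _) x (esL _ _)  y ()
relatePositions (esL _ _)  x (lamC _)   y ()
relatePositions (esL _ _)  x (appL _ _) y ()
relatePositions (esL _ _)  x (appR _ _) y ()

-- Shallow contexts do not enter ES contents: positions in L⟨x⟩ are below x or on the spine of L.
data SpinePosition (L : SubCtx) (x : Tm) (D : Ctx) (y : Tm) : Set where
  below-spine : ∀ D' → D ≡ ctxL L ∘C D' → x ≡ plug D' y → SpinePosition L x D y
  on-spine    : ∀ L₁ v L₂ → L ≡ L₁ ++ v ∷ L₂ → D ≡ ctxL L₁ → y ≡ plugL (v ∷ L₂) x →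
                SpinePosition L x D y

spinePosition : ∀ L x D y → plugL L x ≡ plug D y → SpinePosition L x D y
spinePosition []      x D          y e = below-spine D refl e
spinePosition (u ∷ L) x hole       y e = on-spine [] u L refl refl (sym e)
spinePosition (u ∷ L) x (esL D _)  y e with es-injective e
... | e₁ , refl with spinePosition L x D y e₁
...   | below-spine D' refl e' = below-spine D' refl e'
...   | on-spine L₁ v L₂ refl refl e' = on-spine (u ∷ L₁) v L₂ refl refl e'
spinePosition (u ∷ L) x (lamC _)   y ()
spinePosition (u ∷ L) x (appL _ _) y ()
spinePosition (u ∷ L) x (appR _ _) y ()

-- Renaming, λ-terms and pristine terms

ext-cong : ∀ {f g} → (∀ n → f n ≡ g n) → ∀ n → ext f n ≡ ext g n
ext-cong h zero    = refl
ext-cong h (suc n) = cong suc (h n)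

ren-cong : ∀ {f g} → (∀ n → f n ≡ g n) → ∀ t → ren f t ≡ ren g t
ren-cong h (var n)   = cong var (h n)
ren-cong h (lam t)   = cong lam (ren-cong (ext-cong h) t)
ren-cong h (app t u) = cong₂ app (ren-cong h t) (ren-cong h u)
ren-cong h (es t u)  = cong₂ es (ren-cong (ext-cong h) t) (ren-cong h u)

ext-∘ : ∀ f g n → ext f (ext g n) ≡ ext (f ∘ g) n
ext-∘ f g zero    = refl
ext-∘ f g (suc n) = refl

ren-∘ : ∀ f g t → ren f (ren g t) ≡ ren (f ∘ g) t
ren-∘ f g (var n)   = refl
ren-∘ f g (lam t)   = cong lam (trans (ren-∘ (ext f) (ext g) t) (ren-cong (ext-∘ f g) t))
ren-∘ f g (app t u) = cong₂ app (ren-∘ f g t) (ren-∘ f g u)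
ren-∘ f g (es t u)  =
  cong₂ es (trans (ren-∘ (ext f) (ext g) t) (ren-cong (ext-∘ f g) t)) (ren-∘ f g u)

ext-id : ∀ n → ext id n ≡ n
ext-id zero    = refl
ext-id (suc n) = refl

ren-id : ∀ t → ren id t ≡ t
ren-id (var n)   = refl
ren-id (lam t)   = cong lam (trans (ren-cong ext-id t) (ren-id t))
ren-id (app t u) = cong₂ app (ren-id t) (ren-id u)
ren-id (es t u)  = cong₂ es (trans (ren-cong ext-id t) (ren-id t)) (ren-id u)

ext-injective : ∀ {r} → Injective _≡_ _≡_ r → Injective _≡_ _≡_ (ext r)
ext-injective h {zero}  {zero}  e = refl
ext-injective h {suc x} {suc y} e = cong suc (h (suc-injective e))

+-injective : ∀ k → Injective _≡_ _≡_ (k +_)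
+-injective k = +-cancelˡ-≡ k _ _

extN : ℕ → (ℕ → ℕ) → ℕ → ℕ
extN zero    r = r
extN (suc k) r = extN k (ext r)

extN-injective : ∀ k {r} → Injective _≡_ _≡_ r → Injective _≡_ _≡_ (extN k r)
extN-injective zero    h = h
extN-injective (suc k) h = extN-injective k (ext-injective h)

ren≡plug⇒ : ∀ N r s x → ren r s ≡ plug N x →
  Σ Ctx λ N₀ → Σ Tm λ x₀ → s ≡ plug N₀ x₀ × ren (extN (depth N) r) x₀ ≡ x
ren≡plug⇒ hole r s x e = hole , s , refl , e
ren≡plug⇒ (lamC N) r (lam s) x e with ren≡plug⇒ N (ext r) s x (lam-injective e)
... | N₀ , x₀ , refl , e' = lamC N₀ , x₀ , refl , e'
ren≡plug⇒ (appL N _) r (app a b) x e with ren≡plug⇒ N r a x (proj₁ (app-injective e))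
... | N₀ , x₀ , refl , e' = appL N₀ b , x₀ , refl , e'
ren≡plug⇒ (appR _ N) r (app a b) x e with ren≡plug⇒ N r b x (proj₂ (app-injective e))
... | N₀ , x₀ , refl , e' = appR a N₀ , x₀ , refl , e'
ren≡plug⇒ (esL N _) r (es a b) x e with ren≡plug⇒ N (ext r) a x (proj₁ (es-injective e))
... | N₀ , x₀ , refl , e' = esL N₀ b , x₀ , refl , e'
ren≡plug⇒ (lamC _)   r (var _)   x ()
ren≡plug⇒ (lamC _)   r (app _ _) x ()
ren≡plug⇒ (lamC _)   r (es _ _)  x ()
ren≡plug⇒ (appL _ _) r (var _)   x ()
ren≡plug⇒ (appL _ _) r (lam _)   x ()
ren≡plug⇒ (appL _ _) r (es _ _)  x ()
ren≡plug⇒ (appR _ _) r (var _)   x ()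
ren≡plug⇒ (appR _ _) r (lam _)   x ()
ren≡plug⇒ (appR _ _) r (es _ _)  x ()
ren≡plug⇒ (esL _ _)  r (var _)   x ()
ren≡plug⇒ (esL _ _)  r (lam _)   x ()
ren≡plug⇒ (esL _ _)  r (app _ _) x ()

IsLambda-plug⁻ : ∀ N {y} → IsLambda (plug N y) → IsLambda y
IsLambda-plug⁻ hole       h         = h
IsLambda-plug⁻ (lamC N)   (lam h)   = IsLambda-plug⁻ N h
IsLambda-plug⁻ (appL N _) (app h _) = IsLambda-plug⁻ N h
IsLambda-plug⁻ (appR _ N) (app _ h) = IsLambda-plug⁻ N h

IsLambda-ren : ∀ r {t} → IsLambda t → IsLambda (ren r t)
IsLambda-ren r var       = var
IsLambda-ren r (lam h)   = lam (IsLambda-ren (ext r) h)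
IsLambda-ren r (app h k) = app (IsLambda-ren r h) (IsLambda-ren r k)

¬IsLambda-plug-es : ∀ D {t u} → ¬ IsLambda (plug D (es t u))
¬IsLambda-plug-es D h with IsLambda-plug⁻ D h
... | ()

esCount-ren : ∀ r t → esCount (ren r t) ≡ esCount t
esCount-ren r (var n)   = refl
esCount-ren r (lam t)   = esCount-ren (ext r) t
esCount-ren r (app t u) = cong₂ _+_ (esCount-ren r t) (esCount-ren r u)
esCount-ren r (es t u)  = cong suc (cong₂ _+_ (esCount-ren (ext r) t) (esCount-ren r u))

IsLambda⇒esCount≡0 : ∀ {t} → IsLambda t → esCount t ≡ 0
IsLambda⇒esCount≡0 var       = refl
IsLambda⇒esCount≡0 (lam h)   = IsLambda⇒esCount≡0 h
IsLambda⇒esCount≡0 (app h k) = cong₂ _+_ (IsLambda⇒esCount≡0 h) (IsLambda⇒esCount≡0 k)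

esCount-plug : ∀ C k {x y} → esCount x ≡ k + esCount y → esCount (plug C x) ≡ k + esCount (plug C y)
esCount-plug hole       k e = e
esCount-plug (lamC C)   k e = esCount-plug C k e
esCount-plug (appL C t) k e = trans (cong (_+ esCount t) (esCount-plug C k e)) (+-assoc k _ _)
esCount-plug (appR t C) k e =
  trans (cong (esCount t +_) (esCount-plug C k e)) (x∙yz≈y∙xz (esCount t) k _)
esCount-plug (esL C u)  k e =
  trans (cong (λ n → suc (n + esCount u)) (esCount-plug C k e))
        (trans (cong suc (+-assoc k _ _)) (sym (+-suc k _)))

esCount-dB-contractum : ∀ L t u w → esCount w ≡ esCount u →
  esCount (plugL L (es t w)) ≡ suc (esCount (app (plugL L (lam t)) u))
esCount-dB-contractum []      t u w e = cong (λ n → suc (esCount t + n)) e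
esCount-dB-contractum (v ∷ L) t u w e =
  cong suc (trans (cong (_+ esCount v) (esCount-dB-contractum L t u w e))
                  (cong suc (xy∙z≈xz∙y (esCount (plugL L (lam t))) (esCount u) (esCount v))))

esCount-dB : ∀ C L t u →
  esCount (plug C (plugL L (es t (weaken (length L) u)))) ≡ suc (esCount (plug C (app (plugL L (lam t)) u)))
esCount-dB C L t u = esCount-plug C 1 (esCount-dB-contractum L t u _ (esCount-ren _ u))

esCount-ls : ∀ D C {u} → IsLambda u →
  esCount (plug D (es (plug C (weaken (suc (depth C)) u)) u)) ≡
  esCount (plug D (es (plug C (var (depth C))) u))
esCount-ls D C {u} λu =
  esCount-plug D 0 (cong (λ n → suc (n + esCount u))
    (esCount-plug C 0 (trans (esCount-ren _ u) (IsLambda⇒esCount≡0 λu))))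

Pristine : Tm → Tm → Set
Pristine t₀ u = IsLambda u × SubtermUpToRenaming u t₀

Pristine-self : ∀ {t₀} → IsLambda t₀ → Pristine t₀ t₀
Pristine-self h = h , hole , _ , id , refl , id , ren-id _

Pristine-ren : ∀ {t₀ u} r → Injective _≡_ _≡_ r → Pristine t₀ u → Pristine t₀ (ren r u)
Pristine-ren r r-inj (λu , C , s , r₀ , e₁ , r₀-inj , e₂) =
  IsLambda-ren r λu , C , s , r ∘ r₀ , e₁ , r₀-inj ∘ r-inj ,
  trans (sym (ren-∘ r r₀ s)) (cong (ren r) e₂)

Pristine-plug⁻ : ∀ {t₀ v} N {y} → Pristine t₀ v → v ≡ plug N y → Pristine t₀ y
Pristine-plug⁻ N (λv , C , s , r , e₁ , r-inj , e₂) refl with ren≡plug⇒ N r s _ e₂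
... | N₀ , x₀ , refl , e =
  IsLambda-plug⁻ N λv , C ∘C N₀ , x₀ , extN (depth N) r ,
  trans (plug-∘ C N₀ x₀) e₁ , extN-injective (depth N) r-inj , e

Pristine-arg : ∀ {t₀ v} N {a b} → Pristine t₀ v → v ≡ plug N (app a b) → Pristine t₀ b
Pristine-arg N {a} {b} h e =
  Pristine-plug⁻ (N ∘C appR a hole) h (trans e (sym (plug-∘ N (appR a hole) b)))

-- Useful redexes

UsefulRedexAt : Tm → List Dir → Set
UsefulRedexAt s q = Σ Tm λ s' → Σ (Step s s') λ st → Useful st × path (pos st) ≡ q

NoUsefulBefore : Tm → List Dir → Set
NoUsefulBefore s q = ∀ {s'} (st : Step s s') → Useful st → q ≼ path (pos st)

LeastUsefulAt : Tm → List Dir → Set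
LeastUsefulAt s q = UsefulRedexAt s q × NoUsefulBefore s q

usefulRedexAt : ∀ {s₀ s s' q} → s₀ ≡ s → (st : Step s₀ s') → Useful st → path (pos st) ≡ q →
  UsefulRedexAt s q
usefulRedexAt refl st u e = _ , st , u , e

NoUsefulBefore⇒≼ : ∀ {s p q} → UsefulRedexAt s p → NoUsefulBefore s q → q ≼ p
NoUsefulBefore⇒≼ (_ , st , u , refl) h = h st u

LOUStep⇒LeastUsefulAt : ∀ {s s'} (st : Step s s') → LOUStep st → LeastUsefulAt s (path (pos st))
LOUStep⇒LeastUsefulAt st (useful , least) = (_ , st , useful , refl) , before
  where
    before : NoUsefulBefore _ (path (pos st))
    before st' useful' with least st' useful'
    ... | inj₁ same = inj₁ (subst (λ C → path (pos st) ⊑ path C) same ⊑-refl)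
    ... | inj₂ lo   = ≺LO⇒≼ lo

Useful-ls-similar : ∀ D C u D' C' → Similar (D ∘C esL C u) (D' ∘C esL C' u) → depth C ≡ depth C' →
  Useful (ls D C u) → Useful (ls D' C' u)
Useful-ls-similar D C u D' C' sim dC = λ where
    (inj₁ β)          → inj₁ (subst HasBeta same β)
    (inj₂ (abs , ap)) → inj₂ (subst IsAbs same abs , similar-applicative sim ap)
  where
    same : unfoldRel (D ∘C esL C u) (weaken (suc (depth C)) u) ≡
           unfoldRel (D' ∘C esL C' u) (weaken (suc (depth C')) u)
    same = trans (similar-unfoldRel sim _)
                 (cong (λ k → unfoldRel (D' ∘C esL C' u) (weaken (suc k) u)) dC)

data ReductRedex (s : Tm) (P : Ctx) (q : List Dir) : Set where
  after    : path P ≼ q → ReductRedex s P q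
  residual : UsefulRedexAt s q → ReductRedex s P q
  -- a dB-redex whose abstraction, under k substitutions, is the new subterm at P
  created  : ∀ k → q ++ fun ∷ replicate k esBody ≡ path P → ReductRedex s P q

reductRedex-dB-fun : ∀ {s} C L t u K Rold Rnew → s ≡ plug (C ∘C appL K u) Rold →
  plugL L (lam t) ≡ plug K Rnew → ReductRedex s (C ∘C appL K u) (path C)
reductRedex-dB-fun C L t u K Rold Rnew eS e with spinePosition L (lam t) K Rnew e
... | below-spine hole refl _ = created (length L) (sym (begin
  path (C ∘C appL (ctxL L ∘C hole) u)     ≡⟨ path-∘ C _ ⟩
  path C ++ fun ∷ path (ctxL L ∘C hole)
    ≡⟨ cong (λ X → path C ++ fun ∷ path X) (∘C-identityʳ (ctxL L)) ⟩
  path C ++ fun ∷ path (ctxL L)           ≡⟨ cong (λ q → path C ++ fun ∷ q) (path-ctxL L) ⟩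
  path C ++ fun ∷ replicate (length L) esBody ∎))
  where open ≡-Reasoning
... | below-spine (appL _ _) refl ()
... | below-spine (appR _ _) refl ()
... | below-spine (esL _ _)  refl ()
... | on-spine L₁ _ _ refl refl _ = created (length L₁)
  (sym (trans (path-∘ C (appL (ctxL L₁) u)) (cong (λ q → path C ++ fun ∷ q) (path-ctxL L₁))))
... | below-spine (lamC D) refl refl = residual (usefulRedexAt source (dB C L (plug D Rold) u) tt refl)
  where
    source : plug C (app (plugL L (lam (plug D Rold))) u) ≡ _
    source = sym (trans eS (trans (plug-∘ C (appL (ctxL L ∘C lamC D) u) Rold)
      (cong (λ z → plug C (app z u)) (trans (plug-∘ (ctxL L) (lamC D) Rold) (plug-ctxL L _)))))

reductRedex-dB : ∀ {s} P Rold Rnew C L t u → s ≡ plug P Rold →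
  plug C (app (plugL L (lam t)) u) ≡ plug P Rnew → ReductRedex s P (path C)
reductRedex-dB P Rold Rnew C L t u eS e with relatePositions P Rnew C _ (sym e)
... | inside P' refl _ = after (inj₁ (subst (path P ⊑_) (sym (path-∘ P P')) (p⊑p++q _ _)))
... | encloses hole       nh _ _ = ⊥-elim (nh refl)
... | encloses (lamC _)   _  _ ()
... | encloses (esL _ _)  _  _ ()
... | encloses (appR _ K) _ refl refl =
  residual (usefulRedexAt (sym (trans eS (plug-∘ C (appR _ K) Rold))) (dB C L t (plug K Rold)) tt refl)
... | leftOf h _ = after (inj₂ h)
... | rightOf _ d =
  let C' , e' , sim = d Rold in
  residual (usefulRedexAt (trans (sym e') (sym eS)) (dB C' L t u) tt (sym (similar-path sim)))
... | encloses (appL K _) _ refl ey with app-injective ey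
...   | e₁ , refl = reductRedex-dB-fun C L t u K Rold Rnew eS e₁

reductRedex-ls : ∀ {s} P Rold Rnew D C u → s ≡ plug P Rold →
  plug D (es (plug C (var (depth C))) u) ≡ plug P Rnew → Useful (ls D C u) →
  ReductRedex s P (path (D ∘C esL C u))
reductRedex-ls P Rold Rnew D C u eS e useful
  with relatePositions P Rnew (D ∘C esL C u) (var (depth C)) (sym (trans (plug-∘ D (esL C u) _) e))
... | inside P' eP _ =
  after (inj₁ (subst (path P ⊑_) (trans (sym (path-∘ P P')) (cong path (sym eP))) (p⊑p++q _ _)))
... | encloses hole       nh _ _ = ⊥-elim (nh refl)
... | encloses (lamC _)   _  _ ()
... | encloses (appL _ _) _  _ ()
... | encloses (appR _ _) _  _ ()
... | encloses (esL _ _)  _  _ ()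
... | leftOf h _ = after (inj₂ h)
... | rightOf _ d with d Rold
...   | K' , e' , sim with similar-split D (esL C u) sim
...     | D' , .(esL C' u) , refl , _ , esL {C' = C'} simC =
  residual (usefulRedexAt source (ls D' C' u)
    (Useful-ls-similar D C u D' C' sim (similar-depth simC) useful) (sym (similar-path sim)))
  where
    source : plug D' (es (plug C' (var (depth C'))) u) ≡ _
    source = trans (sym (plug-∘ D' (esL C' u) _))
      (trans (cong (λ k → plug (D' ∘C esL C' u) (var k)) (sym (similar-depth simC)))
        (trans (sym e') (sym eS)))

reductRedex : ∀ {s s₂ s''} P Rold Rnew → s ≡ plug P Rold → s₂ ≡ plug P Rnew →
  (st : Step s₂ s'') → Useful st → ReductRedex s P (path (pos st))
reductRedex P Rold Rnew eS eS₂ (dB C L t u) _      = reductRedex-dB P Rold Rnew C L t u eS eS₂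
reductRedex P Rold Rnew eS eS₂ (ls D C u)   useful = reductRedex-ls P Rold Rnew D C u eS eS₂ useful

-- The invariant

ESContentsPristine : Tm → Tm → Set
ESContentsPristine t₀ s = ∀ D t u → s ≡ plug D (es t u) → Pristine t₀ u

ArgsPristine : Tm → Tm → Set
ArgsPristine t₀ s = ∀ N a b → s ≡ plug N (app a b) → Pristine t₀ b

ArgsPristineOrSettled : Tm → Tm → Set
ArgsPristineOrSettled t₀ s =
  ∀ N a b → s ≡ plug N (app a b) → Pristine t₀ b ⊎ NoUsefulBefore s (path N ++ arg ∷ [])

Invariant : Tm → Tm → Set
Invariant t₀ s = ESContentsPristine t₀ s × ArgsPristineOrSettled t₀ s

Invariant-init : ∀ {t} → IsLambda t → Invariant t t
Invariant-init h =
  (λ D _ _ e → ⊥-elim (¬IsLambda-plug-es D (subst IsLambda e h))) ,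
  (λ N _ _ e → inj₁ (Pristine-arg N (Pristine-self h) e))

ESContentsPristine-replace : ∀ {t₀ s s'} P Rold Rnew → s ≡ plug P Rold → s' ≡ plug P Rnew →
  ESContentsPristine t₀ s → ESContentsPristine t₀ Rnew → ESContentsPristine t₀ s'
ESContentsPristine-replace P Rold Rnew eS eS' old new D t u eD
  with relatePositions P Rnew D (es t u) (trans (sym eS') eD)
... | inside P' _ e = new P' t u e
... | encloses hole       nh _ _ = ⊥-elim (nh refl)
... | encloses (lamC _)   _  _ ()
... | encloses (appL _ _) _  _ ()
... | encloses (appR _ _) _  _ ()
... | encloses (esL K _)  _ refl refl = old D (plug K Rold) u (trans eS (plug-∘ D (esL K u) Rold))
... | leftOf _ d  = let D' , e , _ = d Rold in old D' t u (trans eS e)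
... | rightOf _ d = let D' , e , _ = d Rold in old D' t u (trans eS e)

-- The only useful redexes that replacement can add before an argument position are
-- created dB-redexes, whose positions lie on the arg-free spine above P.
NoUsefulBefore-replace : ∀ {s s'} P Rold Rnew x → s ≡ plug P Rold → s' ≡ plug P Rnew →
  NoUsefulBefore s (x ++ arg ∷ []) → (x ++ arg ∷ []) ≼ path P → NoUsefulBefore s' (x ++ arg ∷ [])
NoUsefulBefore-replace P Rold Rnew x eS eS' settled q≼P st useful
  with reductRedex P Rold Rnew eS eS' st useful
... | after P≼q   = ≼-trans q≼P P≼q
... | residual r  = NoUsefulBefore⇒≼ r settled
... | created k e = ≼-cut x _ _ (subst (_ ≼_) (sym e) q≼P) (spine-ArgFree k)

ArgsPristineOrSettled-replace : ∀ {t₀ s s'} P Rold Rnew → s ≡ plug P Rold → s' ≡ plug P Rnew →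
  LeastUsefulAt s (path P) → ArgsPristineOrSettled t₀ s → ArgsPristine t₀ Rnew →
  ArgsPristineOrSettled t₀ s'
ArgsPristineOrSettled-replace {s = s} P Rold Rnew eS eS' (redexP , leastP) old new N a b eN
  with relatePositions P Rnew N (app a b) (trans (sym eS') eN)
... | inside P' _ e = inj₁ (new P' a b e)
... | encloses hole       nh _ _ = ⊥-elim (nh refl)
... | encloses (lamC _)   _  _ ()
... | encloses (esL _ _)  _  _ ()
... | encloses (appL K _) _ refl refl =
  map₂ (λ (settled : NoUsefulBefore s _) → ⊥-elim (c++arg∷x⋠c++fun∷y (path N) [] (path K)
         (subst (_ ≼_) (path-∘ N (appL K b)) (NoUsefulBefore⇒≼ redexP settled))))
       (old N (plug K Rold) b (trans eS (plug-∘ N (appL K b) Rold)))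
... | encloses (appR _ K) _ refl refl =
  inj₂ (NoUsefulBefore-replace P Rold Rnew (path N) eS eS'
         (λ st useful → ≼-trans q≼P (leastP st useful)) q≼P)
  where
    q≼P : (path N ++ arg ∷ []) ≼ path (N ∘C appR a K)
    q≼P = inj₁ (subst (_ ⊑_) (sym (path-∘ N (appR a K))) (⊑-++⁺ (path N) (refl ∷ [])))
... | leftOf P◁N d =
  let N' , e , sim = d Rold in
  map₂ (λ (settled : NoUsefulBefore s _) → ⊥-elim (p◁q⇒q++z⋠p (arg ∷ [])
         (subst (path P ◁_) (similar-path sim) P◁N) (NoUsefulBefore⇒≼ redexP settled)))
       (old N' a b (trans eS e))
... | rightOf N◁P d =
  let N' , e , sim = d Rold in
  map₂ (λ (settled : NoUsefulBefore s _) → NoUsefulBefore-replace P Rold Rnew (path N) eS eS'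
         (subst (λ q → NoUsefulBefore s (q ++ arg ∷ [])) (sym (similar-path sim)) settled)
         (inj₂ (◁-extend (arg ∷ []) N◁P)))
       (old N' a b (trans eS e))

¬NoUsefulBefore-below : ∀ {s p} d q → UsefulRedexAt s p → ¬ NoUsefulBefore s (p ++ d ∷ q)
¬NoUsefulBefore-below d q redex settled = p++d∷q⋠p _ d q (NoUsefulBefore⇒≼ redex settled)

plug-redex-body : ∀ C L D u z →
  plug C (app (plugL L (lam (plug D z))) u) ≡ plug (C ∘C appL (ctxL L ∘C lamC D) u) z
plug-redex-body C L D u z = sym (trans (plug-∘ C (appL (ctxL L ∘C lamC D) u) z)
  (cong (λ y → plug C (app y u)) (trans (plug-∘ (ctxL L) (lamC D) z) (plug-ctxL L _))))

dB-argument-pristine : ∀ {t₀} C L t u → UsefulRedexAt (plug C (app (plugL L (lam t)) u)) (path C) →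
  ArgsPristineOrSettled t₀ (plug C (app (plugL L (lam t)) u)) → Pristine t₀ u
dB-argument-pristine C L t u redex argsOld =
  [ id , ⊥-elim ∘ ¬NoUsefulBefore-below arg [] redex ]′ (argsOld C (plugL L (lam t)) u refl)

dB-contractum-args : ∀ {t₀} C L t u → UsefulRedexAt (plug C (app (plugL L (lam t)) u)) (path C) →
  ArgsPristineOrSettled t₀ (plug C (app (plugL L (lam t)) u)) →
  ArgsPristine t₀ (plugL L (es t (weaken (length L) u)))
dB-contractum-args C L t u redex argsOld N a b e with spinePosition L _ N (app a b) e
... | below-spine hole       refl ()
... | below-spine (lamC _)   refl ()
... | below-spine (appL _ _) refl ()
... | below-spine (appR _ _) refl ()
... | on-spine _ _ _ _ _ ()
... | below-spine (esL D _)  refl refl =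
  [ id , ⊥-elim ∘ ¬NoUsefulBefore-below fun _ redex ∘ subst (NoUsefulBefore _) path≡ ]′
  (argsOld (C ∘C appL (ctxL L ∘C lamC D) u) a b (plug-redex-body C L D u (app a b)))
  where
    path≡ : path (C ∘C appL (ctxL L ∘C lamC D) u) ++ arg ∷ [] ≡
            path C ++ fun ∷ (path (ctxL L ∘C lamC D) ++ arg ∷ [])
    path≡ = trans (cong (_++ arg ∷ []) (path-∘ C _)) (++-assoc (path C) _ _)

dB-contractum-ES : ∀ {t₀} C L t u → Pristine t₀ u →
  ESContentsPristine t₀ (plug C (app (plugL L (lam t)) u)) →
  ESContentsPristine t₀ (plugL L (es t (weaken (length L) u)))
dB-contractum-ES C L t u u-pristine esOld D t' u' e with spinePosition L _ D (es t' u') e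
... | below-spine (lamC _)   refl ()
... | below-spine (appL _ _) refl ()
... | below-spine (appR _ _) refl ()
... | below-spine hole       refl refl = Pristine-ren (length L +_) (+-injective (length L)) u-pristine
... | below-spine (esL D' _) refl refl =
  esOld (C ∘C appL (ctxL L ∘C lamC D') u) t' u' (plug-redex-body C L D' u (es t' u'))
... | on-spine L₁ v L₂ refl refl refl =
  esOld (C ∘C appL (ctxL L₁) u) (plugL L₂ (lam t)) v (sym (begin
    plug (C ∘C appL (ctxL L₁) u) (plugL (v ∷ L₂) (lam t))
      ≡⟨ plug-∘ C (appL (ctxL L₁) u) _ ⟩
    plug C (app (plug (ctxL L₁) (plugL (v ∷ L₂) (lam t))) u)
      ≡⟨ cong (λ y → plug C (app y u)) (sym (plugL-++ L₁ (v ∷ L₂) _)) ⟩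
    plug C (app (plugL (L₁ ++ v ∷ L₂) (lam t)) u) ∎))
  where open ≡-Reasoning

dB-preserves : ∀ {t₀} C L t u → LOUStep (dB C L t u) →
  Invariant t₀ (plug C (app (plugL L (lam t)) u)) →
  Invariant t₀ (plug C (plugL L (es t (weaken (length L) u))))
dB-preserves C L t u lou (esOld , argsOld) =
  ESContentsPristine-replace C _ _ refl refl esOld
    (dB-contractum-ES C L t u (dB-argument-pristine C L t u (proj₁ least) argsOld) esOld) ,
  ArgsPristineOrSettled-replace C _ _ refl refl least argsOld
    (dB-contractum-args C L t u (proj₁ least) argsOld)
  where
    least : LeastUsefulAt (plug C (app (plugL L (lam t)) u)) (path C)
    least = LOUStep⇒LeastUsefulAt (dB C L t u) lou

ls-preserves : ∀ {t₀} D C u → LOUStep (ls D C u) →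
  Invariant t₀ (plug D (es (plug C (var (depth C))) u)) →
  Invariant t₀ (plug D (es (plug C (weaken (suc (depth C)) u)) u))
ls-preserves {t₀} D C u lou (esOld , argsOld) =
  ESContentsPristine-replace P x copy (at x) (at copy) esOld esNew ,
  ArgsPristineOrSettled-replace P x copy (at x) (at copy) (LOUStep⇒LeastUsefulAt (ls D C u) lou)
    argsOld argsNew
  where
    P : Ctx
    P = D ∘C esL C u

    x copy : Tm
    x    = var (depth C)
    copy = weaken (suc (depth C)) u

    at : ∀ z → plug D (es (plug C z) u) ≡ plug P z
    at z = sym (plug-∘ D (esL C u) z)

    copy-pristine : Pristine t₀ copy
    copy-pristine =
      Pristine-ren (suc (depth C) +_) (+-injective (suc (depth C))) (esOld D (plug C x) u refl)

    esNew : ESContentsPristine t₀ copy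
    esNew D' _ _ e = ⊥-elim (¬IsLambda-plug-es D' (subst IsLambda e (proj₁ copy-pristine)))

    argsNew : ArgsPristine t₀ copy
    argsNew N _ _ e = Pristine-arg N copy-pristine e

Invariant-step : ∀ {t₀ s s'} (st : Step s s') → LOUStep st → Invariant t₀ s → Invariant t₀ s'
Invariant-step (dB C L t u) = dB-preserves C L t u
Invariant-step (ls D C u)   = ls-preserves D C u

-- The three properties

Shallow-from-ES-contents : ∀ s → (∀ D t u → s ≡ plug D (es t u) → IsLambda u) → Shallow s
Shallow-from-ES-contents (var n)   h = var
Shallow-from-ES-contents (lam t)   h =
  lam (Shallow-from-ES-contents t (λ D t' u e → h (lamC D) t' u (cong lam e)))
Shallow-from-ES-contents (app t v) h =
  app (Shallow-from-ES-contents t (λ D t' u e → h (appL D v) t' u (cong (λ z → app z v) e)))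
      (Shallow-from-ES-contents v (λ D t' u e → h (appR t D) t' u (cong (app t) e)))
Shallow-from-ES-contents (es t v)  h =
  es (Shallow-from-ES-contents t (λ D t' u e → h (esL D v) t' u (cong (λ z → es z v) e)))
     (h hole t v refl)

Invariant⇒Shallow : ∀ {t₀} s → Invariant t₀ s → Shallow s
Invariant⇒Shallow s (esInv , _) = Shallow-from-ES-contents s (λ D t u e → proj₁ (esInv D t u e))

subterm-property : ∀ {t₀ s v} (ρ : Deriv s v) → IsLOU ρ → Invariant t₀ s → SubtermProperty t₀ ρ
subterm-property []                   _            _   = tt
subterm-property (st@(dB _ _ _ _) ∷ ρ) (lou , lous) inv =
  subterm-property ρ lous (Invariant-step st lou inv)
subterm-property (st@(ls D _ u) ∷ ρ)   (lou , lous) inv =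
  proj₂ (proj₁ inv D _ u refl) , subterm-property ρ lous (Invariant-step st lou inv)

trace-property : ∀ {t₀ s v} (ρ : Deriv s v) → IsLOU ρ → Invariant t₀ s →
  esCount v ≡ esCount s + dBCount ρ
trace-property {s = s} [] _ _ = sym (+-identityʳ (esCount s))
trace-property {s = s} (st@(dB C L t u) ∷ ρ) (lou , lous) inv = begin
  _                                             ≡⟨ trace-property ρ lous (Invariant-step st lou inv) ⟩
  esCount (plug C (plugL L (es t _))) + dBCount ρ ≡⟨ cong (_+ dBCount ρ) (esCount-dB C L t u) ⟩
  suc (esCount s) + dBCount ρ                   ≡⟨ sym (+-suc (esCount s) (dBCount ρ)) ⟩
  esCount s + suc (dBCount ρ)                   ∎
  where open ≡-Reasoning
trace-property (st@(ls D C u) ∷ ρ) (lou , lous) inv =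
  trans (trace-property ρ lous (Invariant-step st lou inv))
        (cong (_+ dBCount ρ) (esCount-ls D C (proj₁ (proj₁ inv D _ u refl))))

shallow-terms : ∀ {t₀ s v} (ρ : Deriv s v) → IsLOU ρ → Invariant t₀ s → All Shallow (terms ρ)
shallow-terms {s = s} []       _            inv = Invariant⇒Shallow s inv ∷ []
shallow-terms {s = s} (st ∷ ρ) (lou , lous) inv =
  Invariant⇒Shallow s inv ∷ shallow-terms ρ lous (Invariant-step st lou inv)

mainTheorem14 : ∀ {t u} → IsLambda t → (ρ : Deriv t u) → IsLOU ρ →
    SubtermProperty t ρ × esCount u ≡ dBCount ρ × All Shallow (terms ρ)
mainTheorem14 {t} λt ρ lou =
  subterm-property ρ lou inv ,
  trans (trace-property ρ lou inv) (cong (_+ dBCount ρ) (IsLambda⇒esCount≡0 λt)) ,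
  shallow-terms ρ lou inv
  where
    inv : Invariant t t
    inv = Invariant-init λt
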